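{- Let $F$ be a filter of a residuated lattice $L$. Then (1) $\mathrm{Soc}(F)=F\cap\mathrm{Soc}(L)$; and (2) $\mathrm{Soc}(\mathrm{Soc}(F))=\mathrm{Soc}(F)$.
   Context: A residuated lattice is an algebra $(L,\wedge,\vee,\odot,\rightarrow,0,1)$ such that $(L,\wedge,\vee,0,1)$ is a bounded lattice, $(L,\odot,1)$ is a commutative monoid, and $x\odot z\le y$ iff $z\le x\rightarrow y$. A filter is a nonempty subset closed under $\odot$ and upward closed; the join of a family of filters is the smallest filter containing their union. A filter $T$ is simple if $T\neq\{1\}$ and the only filters contained in $T$ are $\{1\}$ and $T$. For a filter $F$ (including $F=L$), $\mathrm{Soc}(F)$ is the join of all simple filters contained in $F$ if there is at least one, and $\{1\}$ otherwise. -}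

module Defs where

open import Level using (Level; _⊔_; suc)
open import Data.Product using (Σ; _×_; _,_)
open import Data.Sum using (_⊎_)
open import Data.List using (List; foldr)
open import Data.List.Relation.Unary.All using (All)
open import Relation.Nullary using (¬_)
open import Relation.Unary using (Pred; _⊆_; _≐_; _∈_; U)
open import Relation.Binary.PropositionalEquality using (_≡_)
open import Algebra.Core using (Op₂)
open import Algebra.Structures using (IsCommutativeMonoid)
open import Algebra.Lattice.Structures using (IsLattice)

record ResiduatedLattice (a : Level) : Set (suc a) where
  infixr 7 _∧_
  infixr 6 _∨_
  infixl 8 _⊙_
  infixr 5 _⇒_
  infix 4 _≤_
  field
    Carrier : Set a
    _∧_ _∨_ _⊙_ _⇒_ : Op₂ Carrier
    0# 1# : Carrier
    isLattice : IsLattice _≡_ _∨_ _∧_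
    ⊙-isCommutativeMonoid : IsCommutativeMonoid _≡_ _⊙_ 1#

  _≤_ : Carrier → Carrier → Set a
  x ≤ y = x ∧ y ≡ x

  field
    0-least : ∀ x → 0# ≤ x
    1-greatest : ∀ x → x ≤ 1#
    residuation₁ : ∀ x y z → x ⊙ z ≤ y → z ≤ x ⇒ y
    residuation₂ : ∀ x y z → z ≤ x ⇒ y → x ⊙ z ≤ y

module _ {a : Level} (L : ResiduatedLattice a) where
  open ResiduatedLattice L

  record IsFilter {ℓ : Level} (F : Pred Carrier ℓ) : Set (a ⊔ ℓ) where
    field
      nonempty : Σ Carrier λ x → x ∈ F
      ⊙-closed : ∀ {x y} → x ∈ F → y ∈ F → x ⊙ y ∈ F
      up-closed : ∀ {x y} → x ∈ F → x ≤ y → y ∈ F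

  ⟨1⟩ : Pred Carrier a
  ⟨1⟩ x = x ≡ 1#

  record IsSimple (T : Pred Carrier a) : Set (suc a) where
    field
      isFilter : IsFilter T
      nontrivial : ¬ (T ≐ ⟨1⟩)
      minimal : ∀ (G : Pred Carrier a) → IsFilter G → G ⊆ T → (G ≐ ⟨1⟩) ⊎ (G ≐ T)

  -- The filter generated by a subset X, i.e. the smallest filter containing X:
  -- { x | x ≥ x₁ ⊙ ⋯ ⊙ xₙ for some n ≥ 0 and x₁,…,xₙ ∈ X }.
  -- The join of a family of filters is the filter generated by their union.
  ⟨_⟩ : {ℓ : Level} → Pred Carrier ℓ → Pred Carrier (a ⊔ ℓ)
  ⟨ X ⟩ x = Σ (List Carrier) λ xs → All X xs × (foldr _⊙_ 1# xs ≤ x)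

  SimpleUnion : {ℓ : Level} → Pred Carrier ℓ → Pred Carrier (suc a ⊔ ℓ)
  SimpleUnion F x = Σ (Pred Carrier a) λ T → IsSimple T × (T ⊆ F) × (x ∈ T)

  -- Soc(F): join of all simple filters contained in F (= {1} if there are none,
  -- since the join of the empty family is {1}).
  Soc : {ℓ : Level} → Pred Carrier ℓ → Pred Carrier (suc a ⊔ ℓ)
  Soc F = ⟨ SimpleUnion F ⟩

  Whole : Pred Carrier Level.zero
  Whole = U

{-# OPTIONS --safe #-}
-- If x ∈ F lies above a product b₁ ⊙ ⋯ ⊙ bₙ with each bᵢ in a simple filter Tᵢ, then the
-- inequality (p ∨ c) ⊙ (q ∨ c) ≤ p ⊙ q ∨ c, which follows from residuation, gives
-- x = (b₁ ⊙ ⋯ ⊙ bₙ) ∨ x ≥ (b₁ ∨ x) ⊙ ⋯ ⊙ (bₙ ∨ x), where bᵢ ∨ x ∈ Tᵢ ∩ F. Being a subfilter of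
-- the simple filter Tᵢ, Tᵢ ∩ F is either {1}, so that bᵢ ∨ x = 1, or Tᵢ itself, so that Tᵢ ⊆ F;
-- either way bᵢ ∨ x ∈ Soc(F), hence x ∈ Soc(F). Idempotence holds because every simple filter
-- contained in F is contained in Soc(F), and Soc(G) ⊆ G for every filter G.
module Submission where

open import Defs
open import Level using (Level)
open import Data.Product using (_×_; _,_; proj₁; proj₂)
open import Data.Sum using (_⊎_; inj₁; inj₂)
open import Function using (case_of_)
open import Data.Unit using (tt)
open import Data.List using (List; []; _∷_; _++_; foldr; map)
open import Data.List.Relation.Unary.All using (All; []; _∷_)
import Data.List.Relation.Unary.All as All
open import Data.List.Relation.Unary.All.Properties using (++⁺; map⁺)
open import Relation.Unary using (Pred; _≐_; _∩_; _⊆_; _∈_)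
open import Relation.Binary.PropositionalEquality
  using (_≡_; isEquivalence; sym; trans; cong; cong₂; subst; subst₂)
open import Relation.Binary.Bundles using (Poset)
open import Algebra.Structures using (IsCommutativeMonoid)
open import Algebra.Lattice.Bundles using (Lattice)
import Algebra.Lattice.Properties.Lattice as LatticeProperties
import Relation.Binary.Lattice as OrderLattice
import Relation.Binary.Lattice.Properties.JoinSemilattice as JoinSemilatticeProperties
import Relation.Binary.Reasoning.PartialOrder as PosetReasoning

module ResiduatedLatticeProperties {a : Level} (L : ResiduatedLattice a) where
  open ResiduatedLattice L
  open IsCommutativeMonoid ⊙-isCommutativeMonoid
    using ()
    renaming (assoc to ⊙-assoc; comm to ⊙-comm; identityˡ to ⊙-identityˡ; identityʳ to ⊙-identityʳ)

  -- The library's lattice order is x ≡ x ∧ y, the symmetric form of the order x ∧ y ≡ x used here.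
  private
    lattice : Lattice a a
    lattice = record { isLattice = isLattice }

    module Std = OrderLattice.Lattice (LatticeProperties.∨-∧-orderTheoreticLattice lattice)
    module StdJoin = JoinSemilatticeProperties Std.joinSemilattice

  ≤-poset : Poset a a a
  ≤-poset = record
    { _≈_ = _≡_
    ; _≤_ = _≤_
    ; isPartialOrder = record
      { isPreorder = record
        { isEquivalence = isEquivalence
        ; reflexive = λ x≡y → sym (Std.reflexive x≡y)
        ; trans = λ x≤y y≤z → sym (Std.trans (sym x≤y) (sym y≤z))
        }
      ; antisym = λ x≤y y≤x → Std.antisym (sym x≤y) (sym y≤x)
      }
    }

  open Poset ≤-poset public
    using () renaming (refl to ≤-refl; reflexive to ≤-reflexive; trans to ≤-trans)

  x≤x∨y : ∀ x y → x ≤ x ∨ y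
  x≤x∨y x y = sym (Std.x≤x∨y x y)

  y≤x∨y : ∀ x y → y ≤ x ∨ y
  y≤x∨y x y = sym (Std.y≤x∨y x y)

  ∨-least : ∀ {x y z} → x ≤ z → y ≤ z → x ∨ y ≤ z
  ∨-least x≤z y≤z = sym (Std.∨-least (sym x≤z) (sym y≤z))

  ∨-mono-≤ : ∀ {x y u v} → x ≤ y → u ≤ v → x ∨ u ≤ y ∨ v
  ∨-mono-≤ x≤y u≤v = sym (StdJoin.∨-monotonic (sym x≤y) (sym u≤v))

  ⊙-monoʳ-≤ : ∀ x {y z} → y ≤ z → x ⊙ y ≤ x ⊙ z
  ⊙-monoʳ-≤ x {y} {z} y≤z =
    residuation₂ x (x ⊙ z) y (≤-trans y≤z (residuation₁ x (x ⊙ z) z ≤-refl))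

  ⊙-monoˡ-≤ : ∀ x {y z} → y ≤ z → y ⊙ x ≤ z ⊙ x
  ⊙-monoˡ-≤ x {y} {z} y≤z = subst₂ _≤_ (⊙-comm x y) (⊙-comm x z) (⊙-monoʳ-≤ x y≤z)

  ⊙-mono-≤ : ∀ {x y u v} → x ≤ y → u ≤ v → x ⊙ u ≤ y ⊙ v
  ⊙-mono-≤ {y = y} {u} x≤y u≤v = ≤-trans (⊙-monoˡ-≤ u x≤y) (⊙-monoʳ-≤ y u≤v)

  x⊙y≤y : ∀ x y → x ⊙ y ≤ y
  x⊙y≤y x y = subst (x ⊙ y ≤_) (⊙-identityˡ y) (⊙-monoˡ-≤ y (1-greatest x))

  x⊙y≤x : ∀ x y → x ⊙ y ≤ x
  x⊙y≤x x y = subst (_≤ x) (⊙-comm y x) (x⊙y≤y y x)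

  ⊙-distribˡ-∨-≤ : ∀ x y z → x ⊙ (y ∨ z) ≤ x ⊙ y ∨ x ⊙ z
  ⊙-distribˡ-∨-≤ x y z = residuation₂ x _ (y ∨ z) (∨-least
    (residuation₁ x _ y (x≤x∨y _ _))
    (residuation₁ x _ z (y≤x∨y _ _)))

  ⊙-distribʳ-∨-≤ : ∀ x y z → (y ∨ z) ⊙ x ≤ y ⊙ x ∨ z ⊙ x
  ⊙-distribʳ-∨-≤ x y z =
    subst₂ _≤_ (⊙-comm x (y ∨ z)) (cong₂ _∨_ (⊙-comm x y) (⊙-comm x z)) (⊙-distribˡ-∨-≤ x y z)

  [x∨z]⊙[y∨z]≤x⊙y∨z : ∀ x y z → (x ∨ z) ⊙ (y ∨ z) ≤ x ⊙ y ∨ z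
  [x∨z]⊙[y∨z]≤x⊙y∨z x y z = begin
    (x ∨ z) ⊙ (y ∨ z)          ≤⟨ ⊙-distribʳ-∨-≤ (y ∨ z) x z ⟩
    x ⊙ (y ∨ z) ∨ z ⊙ (y ∨ z)  ≤⟨ ∨-mono-≤ (⊙-distribˡ-∨-≤ x y z) (x⊙y≤x z (y ∨ z)) ⟩
    (x ⊙ y ∨ x ⊙ z) ∨ z        ≤⟨ ∨-least (∨-mono-≤ ≤-refl (x⊙y≤y x z)) (y≤x∨y _ _) ⟩
    x ⊙ y ∨ z                  ∎
    where open PosetReasoning ≤-poset

  ∏ : List Carrier → Carrier
  ∏ = foldr _⊙_ 1#

  ∏-++ : ∀ xs ys → ∏ (xs ++ ys) ≡ ∏ xs ⊙ ∏ ys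
  ∏-++ []       ys = sym (⊙-identityˡ (∏ ys))
  ∏-++ (x ∷ xs) ys = trans (cong (x ⊙_) (∏-++ xs ys)) (sym (⊙-assoc x (∏ xs) (∏ ys)))

  ∏-map-∨-≤ : ∀ z xs → ∏ (map (_∨ z) xs) ≤ ∏ xs ∨ z
  ∏-map-∨-≤ z []       = x≤x∨y 1# z
  ∏-map-∨-≤ z (x ∷ xs) = ≤-trans (⊙-monoʳ-≤ (x ∨ z) (∏-map-∨-≤ z xs)) ([x∨z]⊙[y∨z]≤x⊙y∨z x (∏ xs) z)

  module _ {ℓ} {F : Pred Carrier ℓ} (F-filter : IsFilter L F) where
    open IsFilter F-filter

    1∈F : 1# ∈ F
    1∈F = let x , x∈F = nonempty in up-closed x∈F (1-greatest x)

    ∏-∈ : ∀ {xs} → All F xs → ∏ xs ∈ F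
    ∏-∈ []           = 1∈F
    ∏-∈ (x∈F ∷ xs∈F) = ⊙-closed x∈F (∏-∈ xs∈F)

    ⟨⟩-least : ∀ {ℓ′} {X : Pred Carrier ℓ′} → X ⊆ F → ⟨_⟩ L X ⊆ F
    ⟨⟩-least X⊆F (xs , xs∈X , ∏xs≤x) = up-closed (∏-∈ (All.map X⊆F xs∈X)) ∏xs≤x

  ∩-isFilter : ∀ {ℓ ℓ′} {F : Pred Carrier ℓ} {G : Pred Carrier ℓ′} →
               IsFilter L F → IsFilter L G → IsFilter L (F ∩ G)
  ∩-isFilter F-filter G-filter = record
    { nonempty = 1# , 1∈F F-filter , 1∈F G-filter
    ; ⊙-closed = λ (x∈F , x∈G) (y∈F , y∈G) → F.⊙-closed x∈F y∈F , G.⊙-closed x∈G y∈G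
    ; up-closed = λ (x∈F , x∈G) x≤y → F.up-closed x∈F x≤y , G.up-closed x∈G x≤y
    }
    where
    module F = IsFilter F-filter
    module G = IsFilter G-filter

  ⟨⟩-isFilter : ∀ {ℓ} (X : Pred Carrier ℓ) → IsFilter L (⟨_⟩ L X)
  ⟨⟩-isFilter X = record
    { nonempty = 1# , [] , [] , ≤-refl
    ; ⊙-closed = λ (xs , xs∈X , ∏xs≤x) (ys , ys∈X , ∏ys≤y) →
        xs ++ ys , ++⁺ xs∈X ys∈X , subst (_≤ _) (sym (∏-++ xs ys)) (⊙-mono-≤ ∏xs≤x ∏ys≤y)
    ; up-closed = λ (xs , xs∈X , ∏xs≤x) x≤y → xs , xs∈X , ≤-trans ∏xs≤x x≤y
    }

  ⟨⟩-extensive : ∀ {ℓ} {X : Pred Carrier ℓ} → X ⊆ ⟨_⟩ L X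
  ⟨⟩-extensive {x = x} x∈X = x ∷ [] , x∈X ∷ [] , ≤-reflexive (⊙-identityʳ x)

  ⟨⟩-mono : ∀ {ℓ ℓ′} {X : Pred Carrier ℓ} {Y : Pred Carrier ℓ′} → X ⊆ Y → ⟨_⟩ L X ⊆ ⟨_⟩ L Y
  ⟨⟩-mono X⊆Y (xs , xs∈X , ∏xs≤x) = xs , All.map X⊆Y xs∈X , ∏xs≤x

  ∈⟨⟩-by-joins : ∀ {ℓ ℓ′} {X : Pred Carrier ℓ} {Y : Pred Carrier ℓ′} {x} →
                 (∀ {b} → b ∈ X → b ∨ x ∈ ⟨_⟩ L Y) → x ∈ ⟨_⟩ L X → x ∈ ⟨_⟩ L Y
  ∈⟨⟩-by-joins {Y = Y} {x} b∨x∈⟨Y⟩ (bs , bs∈X , ∏bs≤x) = up-closed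
    (∏-∈ (⟨⟩-isFilter Y) (map⁺ (All.map b∨x∈⟨Y⟩ bs∈X)))
    (≤-trans (∏-map-∨-≤ x bs) (∨-least ∏bs≤x ≤-refl))
    where open IsFilter (⟨⟩-isFilter Y)

  simple⇒⊆⊎∩⊆⟨1⟩ : ∀ {T F : Pred Carrier a} → IsSimple L T → IsFilter L F →
                   T ⊆ F ⊎ T ∩ F ⊆ ⟨1⟩ L
  simple⇒⊆⊎∩⊆⟨1⟩ {T} {F} T-simple F-filter
    with minimal (T ∩ F) (∩-isFilter isFilter F-filter) proj₁
    where open IsSimple T-simple
  ... | inj₁ (T∩F⊆⟨1⟩ , _) = inj₂ T∩F⊆⟨1⟩
  ... | inj₂ (_ , T⊆T∩F)   = inj₁ (λ x∈T → proj₂ (T⊆T∩F x∈T))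

  module _ {ℓ} {F : Pred Carrier ℓ} where

    Soc-isFilter : IsFilter L (Soc L F)
    Soc-isFilter = ⟨⟩-isFilter (SimpleUnion L F)

    Soc-⊆ : IsFilter L F → Soc L F ⊆ F
    Soc-⊆ F-filter = ⟨⟩-least F-filter (λ (_ , _ , T⊆F , x∈T) → T⊆F x∈T)

    Soc-mono : ∀ {ℓ′} {G : Pred Carrier ℓ′} → F ⊆ G → Soc L F ⊆ Soc L G
    Soc-mono F⊆G = ⟨⟩-mono λ (T , T-simple , T⊆F , x∈T) →
      T , T-simple , (λ y∈T → F⊆G (T⊆F y∈T)) , x∈T

    simple⊆Soc : ∀ {T} → IsSimple L T → T ⊆ F → T ⊆ Soc L F
    simple⊆Soc {T} T-simple T⊆F x∈T = ⟨⟩-extensive {X = SimpleUnion L F} (T , T-simple , T⊆F , x∈T)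

    Soc⊆Soc-Soc : Soc L F ⊆ Soc L (Soc L F)
    Soc⊆Soc-Soc = ⟨⟩-mono λ (T , T-simple , T⊆F , x∈T) →
      T , T-simple , simple⊆Soc T-simple T⊆F , x∈T

  Soc⊆∩Soc-Whole : ∀ {ℓ} {F : Pred Carrier ℓ} → IsFilter L F → Soc L F ⊆ F ∩ Soc L (Whole L)
  Soc⊆∩Soc-Whole F-filter x∈SocF = Soc-⊆ F-filter x∈SocF , Soc-mono (λ _ → tt) x∈SocF

  ∩Soc-Whole⊆Soc : ∀ {F : Pred Carrier a} → IsFilter L F → F ∩ Soc L (Whole L) ⊆ Soc L F
  ∩Soc-Whole⊆Soc {F} F-filter {x} (x∈F , x∈SocL) = ∈⟨⟩-by-joins b∨x∈SocF x∈SocL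
    where
    b∨x∈SocF : ∀ {b} → b ∈ SimpleUnion L (Whole L) → b ∨ x ∈ Soc L F
    b∨x∈SocF {b} (T , T-simple , _ , b∈T) =
      case simple⇒⊆⊎∩⊆⟨1⟩ T-simple F-filter of λ where
        (inj₁ T⊆F)      → simple⊆Soc T-simple T⊆F b∨x∈T
        (inj₂ T∩F⊆⟨1⟩) → subst (_∈ Soc L F) (sym (T∩F⊆⟨1⟩ (b∨x∈T , b∨x∈F))) (1∈F Soc-isFilter)
      where
      b∨x∈T : b ∨ x ∈ T
      b∨x∈T = IsFilter.up-closed (IsSimple.isFilter T-simple) b∈T (x≤x∨y b x)
      b∨x∈F : b ∨ x ∈ F
      b∨x∈F = IsFilter.up-closed F-filter x∈F (y≤x∨y b x)

theorem4p3 : {a : Level} (L : ResiduatedLattice a) (F : Pred (ResiduatedLattice.Carrier L) a) →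
    IsFilter L F →
    (Soc L F ≐ (F ∩ Soc L (Whole L))) × (Soc L (Soc L F) ≐ Soc L F)
theorem4p3 L F F-filter =
  (Soc⊆∩Soc-Whole F-filter , ∩Soc-Whole⊆Soc F-filter) , (Soc-⊆ Soc-isFilter , Soc⊆Soc-Soc)
  where open ResiduatedLatticeProperties L
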